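{- For $n\ge1$ let $E_n=A(2n-1,n)$ be the central Eulerian number. Then $$E_n\equiv\begin{cases}1\pmod 3&\text{if } n\in T(01)+1,\\ 0\pmod 3&\text{otherwise.}\end{cases}$$
   Context: The Eulerian number $A(n,k)$ is the number of permutations of $\{1,\ldots,n\}$ with exactly $k-1$ descents; equivalently $A(n,k)=\sum_{i=0}^{k}(-1)^i(k-i)^n\binom{n+1}{i}$. $T(01)$ denotes the set of $m\in\mathbb{N}$ whose base-$3$ expansion contains only digits $0$ and $1$, and $T(01)+1=\{m+1: m\in T(01)\}$. -}

module Defs where

open import Data.Nat using (ℕ; zero; suc; _∸_; _*_; _+_)
open import Data.Nat.Combinatorics using (_C_)
open import Data.Integer as ℤ using (ℤ; +_)
open import Data.Product using (Σ; _×_)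
open import Relation.Binary.PropositionalEquality using (_≡_)

sign : ℕ → ℤ
sign zero = + 1
sign (suc i) = ℤ.- sign i

sumTo : ℕ → (ℕ → ℤ) → ℤ
sumTo zero f = f 0
sumTo (suc m) f = sumTo m f ℤ.+ f (suc m)

A : ℕ → ℕ → ℤ
A n k = sumTo k (λ i → sign i ℤ.* (+ (((k ∸ i) Data.Nat.^ n) * ((suc n) C i))))

E : ℕ → ℤ
E n = A ((2 * n) ∸ 1) n

-- m ∈ T(01): the base-3 expansion of m uses only digits 0 and 1.
-- Inductively: 0 ∈ T(01), and if m ∈ T(01) then 3m (append digit 0)
-- and 3m+1 (append digit 1) are in T(01).
data T01 : ℕ → Set where
  t01-zero : T01 0
  t01-app0 : ∀ {m} → T01 m → T01 (3 * m)
  t01-app1 : ∀ {m} → T01 m → T01 (3 * m + 1)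

T01+1 : ℕ → Set
T01+1 n = Σ ℕ (λ m → T01 m × n ≡ suc m)

-- Modulo 3, odd powers act as the identity (x³ ≡ x), so E_{m+1} = A(2m+1, m+1) is congruent to
-- Σ_{i ≤ m+1} (-1)^i (m+1-i) C(2m+2, i), and this sum telescopes, via alternating partial sums of
-- a row of Pascal's triangle, to (-1)^m C(2m, m). By Lucas' theorem, appending a base-3 digit r to m
-- multiplies C(2m, m) by 1, 2 or 0 modulo 3 according as r = 0, 1 or 2, while it multiplies (-1)^m
-- by 1, -1, -1; since -2 ≡ 1, the product (-1)^m C(2m, m) is 1 modulo 3 exactly when all digits
-- of m are 0 or 1, and 0 otherwise.
module Submission where

open import Defs
open import Data.Nat using (ℕ; _≥_)
open import Data.Integer using (+_; _-_)
open import Data.Integer.Divisibility using (_∣_)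
open import Relation.Nullary using (¬_)
open import Data.Product using (_×_)

open import Level using (0ℓ)
open import Data.Nat as ℕ using (zero; suc; z≤n; z<s; s<s; _<_; _≤_; _∸_)
import Data.Nat.Properties as ℕP
open import Data.Nat.Combinatorics using (_C_; nCk+nC[k+1]≡[n+1]C[k+1])
open import Data.Nat.DivMod using (_/_; _%_; m≡m%n+[m/n]*n; m%n<n; m/n<m)
open import Data.Nat.Induction using (<-rec)
open import Data.Integer as ℤ using (ℤ; -_)
import Data.Integer.Properties as ℤP
import Data.Integer.Divisibility.Signed as Signed
open import Data.Integer.Tactic.RingSolver using (solve-∀)
open import Data.Nat.Tactic.RingSolver using () renaming (solve-∀ to ℕ-solve-∀)
open import Data.Product using (_,_; proj₁; proj₂)
open import Data.Sum using (_⊎_; inj₁; inj₂)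
open import Data.Empty using (⊥-elim)
open import Relation.Binary.Bundles using (Setoid)
open import Relation.Binary.PropositionalEquality
import Relation.Binary.Reasoning.Setoid as SetoidReasoning

infix 4 _≡_mod_

-- A record rather than an abbreviation of divisibility, so that a, b and n can be inferred.
record _≡_mod_ (a b n : ℤ) : Set where
  constructor fromDivisibility
  field toDivisibility : n Signed.∣ a - b

open _≡_mod_

≡mod-intro : ∀ {n a b} k → a ≡ b ℤ.+ k ℤ.* n → a ≡ b mod n
≡mod-intro {n} {b = b} k refl = fromDivisibility (Signed.divides k (difference b k n))
  where
  difference : ∀ b k n → b ℤ.+ k ℤ.* n - b ≡ k ℤ.* n
  difference = solve-∀

≡mod-reflexive : ∀ {n a b} → a ≡ b → a ≡ b mod n
≡mod-reflexive {a = a} refl = fromDivisibility (Signed.divides (+ 0) (ℤP.+-inverseʳ a))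

≡mod-refl : ∀ {n a} → a ≡ a mod n
≡mod-refl = ≡mod-reflexive refl

≡mod-sym : ∀ {n a b} → a ≡ b mod n → b ≡ a mod n
≡mod-sym {a = a} {b} (fromDivisibility n∣a-b) =
  fromDivisibility (subst (_ Signed.∣_) (negate a b) (Signed.∣m⇒∣-m n∣a-b))
  where
  negate : ∀ a b → - (a - b) ≡ b - a
  negate = solve-∀

≡mod-trans : ∀ {n a b c} → a ≡ b mod n → b ≡ c mod n → a ≡ c mod n
≡mod-trans {a = a} {b} {c} (fromDivisibility n∣a-b) (fromDivisibility n∣b-c) =
  fromDivisibility (subst (_ Signed.∣_) (telescope a b c) (Signed.∣m∣n⇒∣m+n n∣a-b n∣b-c))
  where
  telescope : ∀ a b c → (a - b) ℤ.+ (b - c) ≡ a - c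
  telescope = solve-∀

+-cong-mod : ∀ {n a b c d} → a ≡ b mod n → c ≡ d mod n → a ℤ.+ c ≡ b ℤ.+ d mod n
+-cong-mod {a = a} {b} {c} {d} (fromDivisibility n∣a-b) (fromDivisibility n∣c-d) =
  fromDivisibility (subst (_ Signed.∣_) (regroup a b c d) (Signed.∣m∣n⇒∣m+n n∣a-b n∣c-d))
  where
  regroup : ∀ a b c d → (a - b) ℤ.+ (c - d) ≡ a ℤ.+ c - (b ℤ.+ d)
  regroup = solve-∀

*-cong-mod : ∀ {n a b c d} → a ≡ b mod n → c ≡ d mod n → a ℤ.* c ≡ b ℤ.* d mod n
*-cong-mod {a = a} {b} {c} {d} (fromDivisibility n∣a-b) (fromDivisibility n∣c-d) =
  fromDivisibility (subst (_ Signed.∣_) (regroup a b c d)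
    (Signed.∣m∣n⇒∣m+n (Signed.∣n⇒∣m*n a n∣c-d) (Signed.∣m⇒∣m*n d n∣a-b)))
  where
  regroup : ∀ a b c d → a ℤ.* (c - d) ℤ.+ (a - b) ℤ.* d ≡ a ℤ.* c - b ℤ.* d
  regroup = solve-∀

≡mod-setoid : ℤ → Setoid 0ℓ 0ℓ
≡mod-setoid n = record
  { Carrier = ℤ
  ; _≈_ = _≡_mod n
  ; isEquivalence = record { refl = ≡mod-refl ; sym = ≡mod-sym ; trans = ≡mod-trans }
  }

module ≡mod-Reasoning (n : ℤ) = SetoidReasoning (≡mod-setoid n)

pos-≡mod : ∀ {a b} k n → a ≡ b ℕ.+ k ℕ.* n → + a ≡ + b mod + n
pos-≡mod {b = b} k n eq =
  ≡mod-intro (+ k) (trans (cong +_ eq) (trans (ℤP.pos-+ b (k ℕ.* n)) (cong (λ z → + b ℤ.+ z) (ℤP.pos-* k n))))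

≡0-mod⇒∣ : ∀ {n a} → a ≡ + 0 mod n → n ∣ a
≡0-mod⇒∣ {a = a} (fromDivisibility n∣a-0) = Signed.∣⇒∣ᵤ (subst (_ Signed.∣_) (ℤP.+-identityʳ a) n∣a-0)

binomial : ℕ → ℕ → ℕ
binomial n zero = 1
binomial zero (suc k) = 0
binomial (suc n) (suc k) = binomial n k ℕ.+ binomial n (suc k)

binomial≡C : ∀ n k → binomial n k ≡ n C k
binomial≡C n zero = refl
binomial≡C zero (suc k) = refl
binomial≡C (suc n) (suc k) =
  trans (cong₂ ℕ._+_ (binomial≡C n k) (binomial≡C n (suc k))) (nCk+nC[k+1]≡[n+1]C[k+1] n k)

binomial-n1≡n : ∀ n → binomial n 1 ≡ n
binomial-n1≡n zero = refl
binomial-n1≡n (suc n) = cong suc (binomial-n1≡n n)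

n<k⇒binomial≡0 : ∀ {n k} → n < k → binomial n k ≡ 0
n<k⇒binomial≡0 {zero} {suc k} _ = refl
n<k⇒binomial≡0 {suc n} {suc k} (s<s n<k) =
  cong₂ ℕ._+_ (n<k⇒binomial≡0 n<k) (n<k⇒binomial≡0 (ℕP.m<n⇒m<1+n n<k))

centralBinomial : ℕ → ℕ
centralBinomial m = binomial (m ℕ.+ m) m

-- Alternating sums along a row of Pascal's triangle

sumTo-cong : ∀ k {f g : ℕ → ℤ} → (∀ i → i ≤ k → f i ≡ g i) → sumTo k f ≡ sumTo k g
sumTo-cong zero f≗g = f≗g 0 z≤n
sumTo-cong (suc k) f≗g =
  cong₂ ℤ._+_ (sumTo-cong k (λ i i≤k → f≗g i (ℕP.m≤n⇒m≤1+n i≤k))) (f≗g (suc k) ℕP.≤-refl)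

sumTo-cong-mod : ∀ {n} k {f g : ℕ → ℤ} → (∀ i → f i ≡ g i mod n) → sumTo k f ≡ sumTo k g mod n
sumTo-cong-mod zero f≈g = f≈g 0
sumTo-cong-mod (suc k) f≈g = +-cong-mod (sumTo-cong-mod k f≈g) (f≈g (suc k))

sumTo-+ : ∀ k (f g : ℕ → ℤ) → sumTo k (λ i → f i ℤ.+ g i) ≡ sumTo k f ℤ.+ sumTo k g
sumTo-+ zero f g = refl
sumTo-+ (suc k) f g =
  trans (cong (ℤ._+ (f (suc k) ℤ.+ g (suc k))) (sumTo-+ k f g))
        (interchange (sumTo k f) (sumTo k g) (f (suc k)) (g (suc k)))
  where
  interchange : ∀ a b c d → a ℤ.+ b ℤ.+ (c ℤ.+ d) ≡ a ℤ.+ c ℤ.+ (b ℤ.+ d)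
  interchange = solve-∀

alternating-partial-sum : ∀ N k →
  sumTo k (λ i → sign i ℤ.* + binomial (suc N) i) ≡ sign k ℤ.* + binomial N k
alternating-partial-sum N zero = refl
alternating-partial-sum N (suc k) = begin
  sumTo k (λ i → sign i ℤ.* + binomial (suc N) i) ℤ.+ - sign k ℤ.* + (b ℕ.+ b′)
    ≡⟨ cong₂ (λ x y → x ℤ.+ - sign k ℤ.* y) (alternating-partial-sum N k) (ℤP.pos-+ b b′) ⟩
  sign k ℤ.* + b ℤ.+ - sign k ℤ.* (+ b ℤ.+ + b′)
    ≡⟨ cancel (sign k) (+ b) (+ b′) ⟩
  - sign k ℤ.* + b′ ∎
  where
  open ≡-Reasoning
  b = binomial N k
  b′ = binomial N (suc k)
  cancel : ∀ s x y → s ℤ.* x ℤ.+ - s ℤ.* (x ℤ.+ y) ≡ - s ℤ.* y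
  cancel = solve-∀

alternating-weighted-sum : ∀ N m →
  sumTo (suc m) (λ i → sign i ℤ.* + ((suc m ∸ i) ℕ.* binomial (suc (suc N)) i))
    ≡ sign m ℤ.* + binomial N m
alternating-weighted-sum N zero = refl
alternating-weighted-sum N (suc m) = begin
  sumTo (suc m) (weighted (suc (suc m))) ℤ.+ weighted (suc (suc m)) (suc (suc m))
    ≡⟨ cong₂ ℤ._+_ (sumTo-cong (suc m) shift) last-term-vanishes ⟩
  sumTo (suc m) (λ i → alternating i ℤ.+ weighted (suc m) i) ℤ.+ + 0
    ≡⟨ ℤP.+-identityʳ _ ⟩
  sumTo (suc m) (λ i → alternating i ℤ.+ weighted (suc m) i)
    ≡⟨ sumTo-+ (suc m) alternating (weighted (suc m)) ⟩
  sumTo (suc m) alternating ℤ.+ sumTo (suc m) (weighted (suc m))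
    ≡⟨ cong₂ ℤ._+_ (alternating-partial-sum (suc N) (suc m)) (alternating-weighted-sum N m) ⟩
  - sign m ℤ.* + (b ℕ.+ b′) ℤ.+ sign m ℤ.* + b
    ≡⟨ cong (λ x → - sign m ℤ.* x ℤ.+ sign m ℤ.* + b) (ℤP.pos-+ b b′) ⟩
  - sign m ℤ.* (+ b ℤ.+ + b′) ℤ.+ sign m ℤ.* + b
    ≡⟨ cancel (sign m) (+ b) (+ b′) ⟩
  - sign m ℤ.* + b′ ∎
  where
  open ≡-Reasoning
  b = binomial N m
  b′ = binomial N (suc m)
  weighted : ℕ → ℕ → ℤ
  weighted k i = sign i ℤ.* + ((k ∸ i) ℕ.* binomial (suc (suc N)) i)
  alternating : ℕ → ℤ
  alternating i = sign i ℤ.* + binomial (suc (suc N)) i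
  shift : ∀ i → i ≤ suc m → weighted (suc (suc m)) i ≡ alternating i ℤ.+ weighted (suc m) i
  shift i i≤1+m = begin
    sign i ℤ.* + ((suc (suc m) ∸ i) ℕ.* c)
      ≡⟨ cong (λ x → sign i ℤ.* + (x ℕ.* c)) (ℕP.+-∸-assoc 1 i≤1+m) ⟩
    sign i ℤ.* + (c ℕ.+ (suc m ∸ i) ℕ.* c)
      ≡⟨ cong (sign i ℤ.*_) (ℤP.pos-+ c _) ⟩
    sign i ℤ.* (+ c ℤ.+ + ((suc m ∸ i) ℕ.* c))
      ≡⟨ ℤP.*-distribˡ-+ (sign i) (+ c) _ ⟩
    alternating i ℤ.+ weighted (suc m) i ∎
    where c = binomial (suc (suc N)) i
  last-term-vanishes : weighted (suc (suc m)) (suc (suc m)) ≡ + 0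
  last-term-vanishes =
    trans (cong (λ x → sign (suc (suc m)) ℤ.* + (x ℕ.* binomial (suc (suc N)) (suc (suc m))))
                (ℕP.n∸n≡0 (suc (suc m))))
          (ℤP.*-zeroʳ (sign (suc (suc m))))
  cancel : ∀ s x y → - s ℤ.* (x ℤ.+ y) ℤ.+ s ℤ.* x ≡ - s ℤ.* y
  cancel = solve-∀

-- Fermat's little theorem for the prime 3

cube-≡mod3 : ∀ x → + (x ℕ.^ 3) ≡ + x mod + 3
cube-≡mod3 zero = ≡mod-refl
cube-≡mod3 (suc x) = begin
  + (suc x ℕ.^ 3)                  ≈⟨ pos-≡mod (x ℕ.* x ℕ.+ x) 3 (binomial-expansion x) ⟩
  + (x ℕ.^ 3 ℕ.+ 1)               ≡⟨ ℤP.pos-+ (x ℕ.^ 3) 1 ⟩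
  + (x ℕ.^ 3) ℤ.+ + 1             ≈⟨ +-cong-mod (cube-≡mod3 x) (≡mod-refl {a = + 1}) ⟩
  + x ℤ.+ + 1                     ≡⟨ sym (ℤP.pos-+ x 1) ⟩
  + (x ℕ.+ 1)                     ≡⟨ cong +_ (ℕP.+-comm x 1) ⟩
  + suc x ∎
  where
  open ≡mod-Reasoning (+ 3)
  binomial-expansion : ∀ x → (1 ℕ.+ x) ℕ.* ((1 ℕ.+ x) ℕ.* ((1 ℕ.+ x) ℕ.* 1))
                              ≡ x ℕ.* (x ℕ.* (x ℕ.* 1)) ℕ.+ 1 ℕ.+ (x ℕ.* x ℕ.+ x) ℕ.* 3
  binomial-expansion = ℕ-solve-∀

odd-power-≡mod3 : ∀ k x → + (x ℕ.^ suc (k ℕ.+ k)) ≡ + x mod + 3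
odd-power-≡mod3 zero x = ≡mod-reflexive (cong +_ (ℕP.*-identityʳ x))
odd-power-≡mod3 (suc k) x = begin
  + (x ℕ.^ suc (suc k ℕ.+ suc k))       ≡⟨ cong (λ e → + (x ℕ.^ suc (suc e))) (ℕP.+-suc k k) ⟩
  + (x ℕ.* (x ℕ.* y))                   ≡⟨ trans (ℤP.pos-* x _) (cong (λ z → + x ℤ.* z) (ℤP.pos-* x y)) ⟩
  + x ℤ.* (+ x ℤ.* + y)                 ≈⟨ *-cong-mod (≡mod-refl {a = + x})
                                             (*-cong-mod (≡mod-refl {a = + x}) (odd-power-≡mod3 k x)) ⟩
  + x ℤ.* (+ x ℤ.* + x)                 ≡⟨ sym (trans (ℤP.pos-* x _) (cong (λ z → + x ℤ.* z) (ℤP.pos-* x x))) ⟩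
  + (x ℕ.* (x ℕ.* x))                   ≡⟨ cong (λ z → + (x ℕ.* (x ℕ.* z))) (sym (ℕP.*-identityʳ x)) ⟩
  + (x ℕ.^ 3)                           ≈⟨ cube-≡mod3 x ⟩
  + x ∎
  where
  open ≡mod-Reasoning (+ 3)
  y = x ℕ.^ suc (k ℕ.+ k)

E≡±centralBinomial-mod3 : ∀ m → E (suc m) ≡ sign m ℤ.* + centralBinomial m mod + 3
E≡±centralBinomial-mod3 m = begin
  E (suc m)
    ≡⟨ cong (λ p → A p (suc m)) exponent ⟩
  A (suc (m ℕ.+ m)) (suc m)
    ≈⟨ sumTo-cong-mod (suc m) (λ i → *-cong-mod (≡mod-refl {a = sign i}) (term i)) ⟩
  sumTo (suc m) (λ i → sign i ℤ.* + ((suc m ∸ i) ℕ.* binomial (suc (suc (m ℕ.+ m))) i))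
    ≡⟨ alternating-weighted-sum (m ℕ.+ m) m ⟩
  sign m ℤ.* + centralBinomial m ∎
  where
  open ≡mod-Reasoning (+ 3)
  exponent : 2 ℕ.* suc m ∸ 1 ≡ suc (m ℕ.+ m)
  exponent = trans (cong (m ℕ.+_) (ℕP.+-identityʳ (suc m))) (ℕP.+-suc m m)
  term : ∀ i → + ((suc m ∸ i) ℕ.^ suc (m ℕ.+ m) ℕ.* (suc (suc (m ℕ.+ m)) C i))
             ≡ + ((suc m ∸ i) ℕ.* binomial (suc (suc (m ℕ.+ m))) i) mod + 3
  term i = begin
    + (x ℕ.^ suc (m ℕ.+ m) ℕ.* (suc (suc (m ℕ.+ m)) C i))
      ≡⟨ ℤP.pos-* (x ℕ.^ suc (m ℕ.+ m)) _ ⟩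
    + (x ℕ.^ suc (m ℕ.+ m)) ℤ.* + (suc (suc (m ℕ.+ m)) C i)
      ≈⟨ *-cong-mod (odd-power-≡mod3 m x)
                    (≡mod-reflexive (cong +_ (sym (binomial≡C (suc (suc (m ℕ.+ m))) i)))) ⟩
    + x ℤ.* + binomial (suc (suc (m ℕ.+ m))) i
      ≡⟨ sym (ℤP.pos-* x _) ⟩
    + (x ℕ.* binomial (suc (suc (m ℕ.+ m))) i) ∎
    where x = suc m ∸ i

-- Lucas' theorem for the prime 3

binomial-3+-≡mod3 : ∀ n k →
  + binomial (3 ℕ.+ n) (3 ℕ.+ k) ≡ + binomial n (3 ℕ.+ k) ℤ.+ + binomial n k mod + 3
binomial-3+-≡mod3 n k =
  pos-≡mod (binomial n (2 ℕ.+ k) ℕ.+ binomial n (1 ℕ.+ k)) 3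
    (pascal³ (binomial n k) (binomial n (1 ℕ.+ k)) (binomial n (2 ℕ.+ k)) (binomial n (3 ℕ.+ k)))
  where
  pascal³ : ∀ a b c d → a ℕ.+ b ℕ.+ (b ℕ.+ c) ℕ.+ (b ℕ.+ c ℕ.+ (c ℕ.+ d))
                        ≡ d ℕ.+ a ℕ.+ (c ℕ.+ b) ℕ.* 3
  pascal³ = ℕ-solve-∀

binomial-3+-small-≡mod3 : ∀ n s → s < 3 → + binomial (3 ℕ.+ n) s ≡ + binomial n s mod + 3
binomial-3+-small-≡mod3 n 0 _ = ≡mod-refl
binomial-3+-small-≡mod3 n 1 _ =
  pos-≡mod 1 3 (trans (cong (3 ℕ.+_) (binomial-n1≡n n))
                      (trans (ℕP.+-comm 3 n) (cong (ℕ._+ 3) (sym (binomial-n1≡n n)))))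
binomial-3+-small-≡mod3 n 2 _ = pos-≡mod (1 ℕ.+ n) 3 pascal²
  where
  pascal² : binomial (3 ℕ.+ n) 2 ≡ binomial n 2 ℕ.+ (1 ℕ.+ n) ℕ.* 3
  pascal² rewrite binomial-n1≡n n = expand n (binomial n 2)
    where
    expand : ∀ n b → suc (suc n ℕ.+ (suc n ℕ.+ (n ℕ.+ b))) ≡ b ℕ.+ (1 ℕ.+ n) ℕ.* 3
    expand = ℕ-solve-∀
binomial-3+-small-≡mod3 n (suc (suc (suc _))) (s<s (s<s (s<s ())))

lucas-≡mod3 : ∀ a b r s → r < 3 → s < 3 →
  + binomial (a ℕ.* 3 ℕ.+ r) (b ℕ.* 3 ℕ.+ s) ≡ + binomial a b ℤ.* + binomial r s mod + 3
lucas-≡mod3 zero zero r s _ _ = ≡mod-reflexive (sym (ℤP.*-identityˡ (+ binomial r s)))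
lucas-≡mod3 zero (suc b) r s r<3 _ =
  ≡mod-reflexive (cong +_ (n<k⇒binomial≡0 (ℕP.<-≤-trans r<3 (ℕP.m≤m+n 3 (b ℕ.* 3 ℕ.+ s)))))
lucas-≡mod3 (suc a) zero r s r<3 s<3 =
  ≡mod-trans (binomial-3+-small-≡mod3 (a ℕ.* 3 ℕ.+ r) s s<3) (lucas-≡mod3 a zero r s r<3 s<3)
lucas-≡mod3 (suc a) (suc b) r s r<3 s<3 = begin
  + binomial (3 ℕ.+ (a ℕ.* 3 ℕ.+ r)) (3 ℕ.+ (b ℕ.* 3 ℕ.+ s))
    ≈⟨ binomial-3+-≡mod3 (a ℕ.* 3 ℕ.+ r) (b ℕ.* 3 ℕ.+ s) ⟩
  + binomial (a ℕ.* 3 ℕ.+ r) (suc b ℕ.* 3 ℕ.+ s) ℤ.+ + binomial (a ℕ.* 3 ℕ.+ r) (b ℕ.* 3 ℕ.+ s)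
    ≈⟨ +-cong-mod (lucas-≡mod3 a (suc b) r s r<3 s<3) (lucas-≡mod3 a b r s r<3 s<3) ⟩
  + binomial a (suc b) ℤ.* + c ℤ.+ + binomial a b ℤ.* + c
    ≡⟨ sym (ℤP.*-distribʳ-+ (+ c) (+ binomial a (suc b)) (+ binomial a b)) ⟩
  (+ binomial a (suc b) ℤ.+ + binomial a b) ℤ.* + c
    ≡⟨ cong (ℤ._* + c) (ℤP.+-comm (+ binomial a (suc b)) (+ binomial a b)) ⟩
  + binomial (suc a) (suc b) ℤ.* + c ∎
  where
  open ≡mod-Reasoning (+ 3)
  c = binomial r s

centralBinomial-lucas-≡mod3 : ∀ q r a s → r < 3 → s < 3 →
  (q ℕ.* 3 ℕ.+ r) ℕ.+ (q ℕ.* 3 ℕ.+ r) ≡ a ℕ.* 3 ℕ.+ s →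
  + centralBinomial (q ℕ.* 3 ℕ.+ r) ≡ + binomial a q ℤ.* + binomial s r mod + 3
centralBinomial-lucas-≡mod3 q r a s r<3 s<3 eq =
  subst (λ n → + binomial n (q ℕ.* 3 ℕ.+ r) ≡ + binomial a q ℤ.* + binomial s r mod + 3) (sym eq)
        (lucas-≡mod3 a q s r s<3 r<3)

base3-unique : ∀ a b r s → r < 3 → s < 3 → a ℕ.* 3 ℕ.+ r ≡ b ℕ.* 3 ℕ.+ s → a ≡ b × r ≡ s
base3-unique zero zero r s _ _ eq = refl , eq
base3-unique zero (suc b) r s (s<s (s<s (s<s ()))) _ refl
base3-unique (suc a) zero r s _ (s<s (s<s (s<s ()))) refl
base3-unique (suc a) (suc b) r s r<3 s<3 eq
  with refl , r≡s ← base3-unique a b r s r<3 s<3 (ℕP.suc-injective (ℕP.suc-injective (ℕP.suc-injective eq)))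
  = refl , r≡s

T01-digits : ∀ {x} → T01 x → ∀ q r → r < 3 → x ≡ q ℕ.* 3 ℕ.+ r → T01 q × r < 2
T01-digits t01-zero q r r<3 eq
  with refl , refl ← base3-unique 0 q 0 r z<s r<3 eq = t01-zero , z<s
T01-digits (t01-app0 {m} t) q r r<3 eq
  with refl , refl ← base3-unique m q 0 r z<s r<3 (trans (trans (ℕP.+-identityʳ (m ℕ.* 3)) (ℕP.*-comm m 3)) eq)
  = t , z<s
T01-digits (t01-app1 {m} t) q r r<3 eq
  with refl , refl ← base3-unique m q 1 r (s<s z<s) r<3 (trans (cong (ℕ._+ 1) (ℕP.*-comm m 3)) eq)
  = t , s<s z<s

sign-base3 : ∀ q r → sign (q ℕ.* 3 ℕ.+ r) ≡ sign q ℤ.* sign r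
sign-base3 zero r = sym (ℤP.*-identityˡ (sign r))
sign-base3 (suc q) r = trans (cong (λ s → - - - s) (sign-base3 q r)) (odd-negation (sign q) (sign r))
  where
  odd-negation : ∀ a b → - - - (a ℤ.* b) ≡ - a ℤ.* b
  odd-negation = solve-∀

centralBinomial-digit0-≡mod3 : ∀ q → + centralBinomial (q ℕ.* 3 ℕ.+ 0) ≡ + centralBinomial q mod + 3
centralBinomial-digit0-≡mod3 q =
  ≡mod-trans (centralBinomial-lucas-≡mod3 q 0 (q ℕ.+ q) 0 z<s z<s (doubling q))
             (≡mod-reflexive (ℤP.*-identityʳ (+ centralBinomial q)))
  where
  doubling : ∀ q → q ℕ.* 3 ℕ.+ 0 ℕ.+ (q ℕ.* 3 ℕ.+ 0) ≡ (q ℕ.+ q) ℕ.* 3 ℕ.+ 0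
  doubling = ℕ-solve-∀

centralBinomial-digit1-≡mod3 : ∀ q →
  + centralBinomial (q ℕ.* 3 ℕ.+ 1) ≡ + centralBinomial q ℤ.* + 2 mod + 3
centralBinomial-digit1-≡mod3 q = centralBinomial-lucas-≡mod3 q 1 (q ℕ.+ q) 2 (s<s z<s) (s<s (s<s z<s)) (doubling q)
  where
  doubling : ∀ q → q ℕ.* 3 ℕ.+ 1 ℕ.+ (q ℕ.* 3 ℕ.+ 1) ≡ (q ℕ.+ q) ℕ.* 3 ℕ.+ 2
  doubling = ℕ-solve-∀

centralBinomial-digit2-≡mod3 : ∀ q → + centralBinomial (q ℕ.* 3 ℕ.+ 2) ≡ + 0 mod + 3
centralBinomial-digit2-≡mod3 q =
  ≡mod-trans (centralBinomial-lucas-≡mod3 q 2 (suc (q ℕ.+ q)) 1 (s<s (s<s z<s)) (s<s z<s) (doubling q))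
             (≡mod-reflexive (ℤP.*-zeroʳ (+ binomial (suc (q ℕ.+ q)) q)))
  where
  doubling : ∀ q → q ℕ.* 3 ℕ.+ 2 ℕ.+ (q ℕ.* 3 ℕ.+ 2) ≡ suc (q ℕ.+ q) ℕ.* 3 ℕ.+ 1
  doubling = ℕ-solve-∀

CentralBinomialMod3 : ℕ → Set
CentralBinomialMod3 m =
  (T01 m × sign m ℤ.* + centralBinomial m ≡ + 1 mod + 3) ⊎ (¬ T01 m × + centralBinomial m ≡ + 0 mod + 3)

append-digit : ∀ q r → r < 3 → CentralBinomialMod3 q → CentralBinomialMod3 (q ℕ.* 3 ℕ.+ r)
append-digit q 0 _ (inj₁ (t , h)) = inj₁ (subst T01 (triple q) (t01-app0 t) , (begin
  sign (q ℕ.* 3 ℕ.+ 0) ℤ.* + centralBinomial (q ℕ.* 3 ℕ.+ 0)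
    ≡⟨ cong (ℤ._* + centralBinomial (q ℕ.* 3 ℕ.+ 0)) (trans (sign-base3 q 0) (ℤP.*-identityʳ (sign q))) ⟩
  sign q ℤ.* + centralBinomial (q ℕ.* 3 ℕ.+ 0)
    ≈⟨ *-cong-mod (≡mod-refl {a = sign q}) (centralBinomial-digit0-≡mod3 q) ⟩
  sign q ℤ.* + centralBinomial q
    ≈⟨ h ⟩
  + 1 ∎))
  where
  open ≡mod-Reasoning (+ 3)
  triple : ∀ q → 3 ℕ.* q ≡ q ℕ.* 3 ℕ.+ 0
  triple = ℕ-solve-∀
append-digit q 0 _ (inj₂ (¬t , h)) =
  inj₂ ((λ t → ¬t (proj₁ (T01-digits t q 0 z<s refl))) , ≡mod-trans (centralBinomial-digit0-≡mod3 q) h)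
append-digit q 1 _ (inj₁ (t , h)) = inj₁ (subst T01 (triple+1 q) (t01-app1 t) , (begin
  sign (q ℕ.* 3 ℕ.+ 1) ℤ.* + centralBinomial (q ℕ.* 3 ℕ.+ 1)
    ≡⟨ cong (ℤ._* + centralBinomial (q ℕ.* 3 ℕ.+ 1)) (sign-base3 q 1) ⟩
  sign q ℤ.* - + 1 ℤ.* + centralBinomial (q ℕ.* 3 ℕ.+ 1)
    ≈⟨ *-cong-mod (≡mod-refl {a = sign q ℤ.* - + 1}) (centralBinomial-digit1-≡mod3 q) ⟩
  sign q ℤ.* - + 1 ℤ.* (+ centralBinomial q ℤ.* + 2)
    ≡⟨ regroup (sign q) (+ centralBinomial q) ⟩
  sign q ℤ.* + centralBinomial q ℤ.* - + 2
    ≈⟨ *-cong-mod h (≡mod-refl {a = - + 2}) ⟩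
  - + 2
    ≈⟨ ≡mod-intro (- + 1) refl ⟩
  + 1 ∎))
  where
  open ≡mod-Reasoning (+ 3)
  triple+1 : ∀ q → 3 ℕ.* q ℕ.+ 1 ≡ q ℕ.* 3 ℕ.+ 1
  triple+1 = ℕ-solve-∀
  regroup : ∀ s b → s ℤ.* - + 1 ℤ.* (b ℤ.* + 2) ≡ s ℤ.* b ℤ.* - + 2
  regroup = solve-∀
append-digit q 1 _ (inj₂ (¬t , h)) =
  inj₂ ((λ t → ¬t (proj₁ (T01-digits t q 1 (s<s z<s) refl))) ,
        ≡mod-trans (centralBinomial-digit1-≡mod3 q) (*-cong-mod h (≡mod-refl {a = + 2})))
append-digit q 2 _ _ =
  inj₂ ((λ t → ℕP.<-irrefl refl (proj₂ (T01-digits t q 2 (s<s (s<s z<s)) refl))) , centralBinomial-digit2-≡mod3 q)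
append-digit q (suc (suc (suc _))) (s<s (s<s (s<s ()))) _

centralBinomial-mod3 : ∀ m → CentralBinomialMod3 m
centralBinomial-mod3 = <-rec CentralBinomialMod3 step
  where
  step : ∀ m → (∀ {k} → k < m → CentralBinomialMod3 k) → CentralBinomialMod3 m
  step zero _ = inj₁ (t01-zero , ≡mod-refl)
  step m@(suc _) below =
    subst CentralBinomialMod3 (sym (trans (m≡m%n+[m/n]*n m 3) (ℕP.+-comm (m % 3) _)))
      (append-digit (m / 3) (m % 3) (m%n<n m 3) (below (m/n<m m 3 (s<s z<s))))

theorem5p9 : (n : ℕ) → n ≥ 1 →
    (T01+1 n → (+ 3) ∣ (E n - + 1)) × (¬ T01+1 n → (+ 3) ∣ E n)
theorem5p9 (suc m) _ with centralBinomial-mod3 m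
... | inj₁ (t , h) =
  (λ _ → Signed.∣⇒∣ᵤ (toDivisibility (≡mod-trans (E≡±centralBinomial-mod3 m) h))) ,
  (λ ¬t → ⊥-elim (¬t (m , t , refl)))
... | inj₂ (¬t , h) =
  (λ { (_ , t , refl) → ⊥-elim (¬t t) }) ,
  (λ _ → ≡0-mod⇒∣ (begin
    E (suc m)                         ≈⟨ E≡±centralBinomial-mod3 m ⟩
    sign m ℤ.* + centralBinomial m    ≈⟨ *-cong-mod (≡mod-refl {a = sign m}) h ⟩
    sign m ℤ.* + 0                    ≡⟨ ℤP.*-zeroʳ (sign m) ⟩
    + 0 ∎))
  where open ≡mod-Reasoning (+ 3)
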